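{- Let $m,K>0$ be integers and let $b_1,\dots,b_m$ be integers with $\gcd(b_1,\dots,b_m)=1$ and $|b_i|\le K$ for all $i$. Let $b$ be an integer with $|b|\le K$. Then there exist integers $c_1,\dots,c_m$ with $|c_i|\le K$ for all $i$ and $b_1c_1+\dots+b_mc_m=b$. -}

module Defs where

open import Data.Nat using (ℕ; zero; suc)
open import Data.Nat.GCD using (gcd)
open import Data.Integer using (ℤ; ∣_∣; _+_; _*_; 0ℤ)
open import Data.Fin using (Fin; zero; suc)

gcdᶠ : ∀ {m : ℕ} → (Fin m → ℤ) → ℕ
gcdᶠ {zero}  b = 0
gcdᶠ {suc m} b = gcd ∣ b zero ∣ (gcdᶠ (λ i → b (suc i)))

dotᶠ : ∀ {m : ℕ} → (Fin m → ℤ) → (Fin m → ℤ) → ℤ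
dotᶠ {zero}  b c = 0ℤ
dotᶠ {suc m} b c = b zero * c zero + dotᶠ (λ i → b (suc i)) (λ i → c (suc i))

-- The proof is by induction on m for the scaled statement: writing g for
-- gcdᶠ bs, if every |bᵢ| ≤ g·K then every g·t with |t| ≤ K is bs·c with
-- |cᵢ| ≤ K  (the predicate 'Spans bs g K').  For the inductive step split
-- bs = b₀ ∷ bs′ with h = gcdᶠ bs′ and g = gcd(|b₀|, h).  If h = 0 the first
-- coefficient alone does the job.  Otherwise |b₀| = q·g and h = d·g with
-- q, d coprime and at most K, and the two-variable case ('two-term') gives
-- q·x + d·y = t with |x|, |y| ≤ K: take x ∈ [0, d) solving q·x ≡ t (mod d)
-- by Bézout; then d·|y| = |t - q·x| ≤ K + K·x ≤ d·K.  The induction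
-- hypothesis writes h·y as bs′·c′, and |b₀|·x + h·y = g·(q·x + d·y) = g·t.
-- The theorem is the case g = 1.
module Submission where

open import Data.Fin using (Fin; zero; suc)
open import Data.Integer as ℤ using (ℤ; ∣_∣; +_; -_; _+_; _-_; _*_; 0ℤ; 1ℤ)
import Data.Integer.Properties as ℤP
open import Data.Integer.DivMod using (_%ℕ_; _/ℕ_; a≡a%ℕn+[a/ℕn]*n; n%ℕd<d)
open import Data.Integer.Tactic.RingSolver using (solve-∀)
open import Data.Nat as ℕ using (ℕ; zero; suc; NonZero) renaming (_≤_ to _≤ℕ_)
import Data.Nat.Properties as ℕP
open import Data.Nat.Coprimality using (Coprime; coprime-Bézout; coprime-/gcd)
open import Data.Nat.Divisibility using (_∣_; ∣-trans; ∣⇒≤; 0∣⇒≡0)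
open import Data.Nat.DivMod using (_/_; m*[n/m]≡n; m≥n⇒m/n>0)
open import Data.Nat.GCD
  using (gcd; gcd[m,n]∣m; gcd[m,n]∣n; gcd[m,n]≤n; gcd[m,n]≢0; gcd-identityʳ; module Bézout)
open import Data.Product using (Σ; _×_; _,_)
open import Data.Sum using (inj₂)
open import Data.Vec.Functional using (_∷_; head; tail)
open import Relation.Binary.PropositionalEquality using (_≡_; refl; sym; trans; cong; cong₂; subst; module ≡-Reasoning)
open import Defs

Spans : ∀ {m} → (Fin m → ℤ) → ℕ → ℕ → Set
Spans {m} bs g K =
  ∀ t → ∣ t ∣ ≤ℕ K → Σ (Fin m → ℤ) λ c → (∀ i → ∣ c i ∣ ≤ℕ K) × dotᶠ bs c ≡ + g * t

gcd-≤ : ∀ {m n B} → m ≤ℕ B → n ≤ℕ B → gcd m n ≤ℕ B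
gcd-≤ {m} {zero}  m≤B _   = subst (_≤ℕ _) (sym (gcd-identityʳ m)) m≤B
gcd-≤ {m} {suc n} _   n≤B = ℕP.≤-trans (gcd[m,n]≤n m (suc n)) n≤B

gcdᶠ-≤ : ∀ {m} (bs : Fin m → ℤ) {B} → (∀ i → ∣ bs i ∣ ≤ℕ B) → gcdᶠ bs ≤ℕ B
gcdᶠ-≤ {zero}  bs bounded = ℕ.z≤n
gcdᶠ-≤ {suc m} bs bounded = gcd-≤ (bounded zero) (gcdᶠ-≤ (tail bs) (λ i → bounded (suc i)))

gcdᶠ-∣ : ∀ {m} (bs : Fin m → ℤ) i → gcdᶠ bs ∣ ∣ bs i ∣
gcdᶠ-∣ {suc m} bs zero    = gcd[m,n]∣m ∣ bs zero ∣ (gcdᶠ (tail bs))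
gcdᶠ-∣ {suc m} bs (suc i) = ∣-trans (gcd[m,n]∣n ∣ bs zero ∣ (gcdᶠ (tail bs))) (gcdᶠ-∣ (tail bs) i)

≤-*-divisor : ∀ {g h n} K → g ∣ h → h ∣ n → n ≤ℕ g ℕ.* K → n ≤ℕ h ℕ.* K
≤-*-divisor {h = zero}  K _   0∣n _   = subst (_≤ℕ 0) (sym (0∣⇒≡0 0∣n)) ℕ.z≤n
≤-*-divisor {h = suc _} K g∣h _   n≤gK = ℕP.≤-trans n≤gK (ℕP.*-monoˡ-≤ K (∣⇒≤ g∣h))

quotient-≤ : ∀ {n g} K .{{_ : NonZero g}} → g ∣ n → n ≤ℕ g ℕ.* K → n / g ≤ℕ K
quotient-≤ {g = g} K g∣n n≤gK =
  ℕP.*-cancelˡ-≤ g (subst (_≤ℕ g ℕ.* K) (sym (m*[n/m]≡n g∣n)) n≤gK)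

ℕ-Bézout⇒ℤ : ∀ x m y n → 1 ℕ.+ y ℕ.* n ≡ x ℕ.* m → + m * + x + + n * - + y ≡ 1ℤ
ℕ-Bézout⇒ℤ x m y n eq = begin
  + m * + x + + n * - + y       ≡⟨ rearrange (+ m) (+ x) (+ n) (+ y) ⟩
  + x * + m - + y * + n         ≡⟨ cong (_- + y * + n) (sym ℤ-eq) ⟩
  1ℤ + + y * + n - + y * + n    ≡⟨ cancel (+ y * + n) ⟩
  1ℤ                            ∎
  where
  open ≡-Reasoning
  ℤ-eq : 1ℤ + + y * + n ≡ + x * + m
  ℤ-eq = begin
    1ℤ + + y * + n      ≡⟨ cong (λ z → 1ℤ + z) (sym (ℤP.pos-* y n)) ⟩
    + (1 ℕ.+ y ℕ.* n)   ≡⟨ cong +_ eq ⟩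
    + (x ℕ.* m)         ≡⟨ ℤP.pos-* x m ⟩
    + x * + m           ∎
  rearrange : ∀ M X N Y → M * X + N * - Y ≡ X * M - Y * N
  rearrange = solve-∀
  cancel : ∀ A → 1ℤ + A - A ≡ 1ℤ
  cancel = solve-∀

coprime⇒ℤ-Bézout : ∀ {q d} → Coprime q d → Σ ℤ λ u → Σ ℤ λ v → + q * u + + d * v ≡ 1ℤ
coprime⇒ℤ-Bézout {q} {d} cop with coprime-Bézout cop
... | Bézout.+- x y eq = + x , - + y , ℕ-Bézout⇒ℤ x q y d eq
... | Bézout.-+ x y eq = - + x , + y ,
  trans (ℤP.+-comm (+ q * - + x) (+ d * + y)) (ℕ-Bézout⇒ℤ y d x q eq)

absorb-sign : ∀ b t → Σ ℤ λ c → b * c ≡ + ∣ b ∣ * t × ∣ c ∣ ≡ ∣ t ∣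
absorb-sign (+ n)      t = t , refl , refl
absorb-sign (ℤ.-[1+ n ]) t = - t , neg-neg (+ suc n) t , ℤP.∣-i∣≡∣i∣ t
  where
  neg-neg : ∀ A T → (- A) * (- T) ≡ A * T
  neg-neg = solve-∀

-- Take x = (u·t) mod d where
-- q·u + d·v = 1; then d·|y| = |t - q·x| ≤ K + K·x ≤ d·K.
two-term : ∀ {q d K} .{{_ : NonZero d}} → Coprime q d → q ≤ℕ K → d ≤ℕ K →
  ∀ t → ∣ t ∣ ≤ℕ K → Σ ℤ λ x → Σ ℤ λ y → ∣ x ∣ ≤ℕ K × ∣ y ∣ ≤ℕ K × + q * x + + d * y ≡ t
two-term {q} {d} {K} cop q≤K d≤K t t≤K with coprime⇒ℤ-Bézout cop
... | u , v , bézout = + r , y , ℕP.≤-trans (ℕP.<⇒≤ r<d) d≤K , y≤K , solves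
  where
  r : ℕ
  r = (u * t) %ℕ d
  k : ℤ
  k = (u * t) /ℕ d
  y : ℤ
  y = v * t + k * + q
  r<d : r ℕ.< d
  r<d = n%ℕd<d (u * t) d

  solves : + q * + r + + d * y ≡ t
  solves = begin
    + q * + r + + d * y                ≡⟨ regroup (+ q) (+ r) k (+ d) v t ⟩
    + q * (+ r + k * + d) + + d * v * t ≡⟨ cong (λ z → + q * z + + d * v * t) (sym (a≡a%ℕn+[a/ℕn]*n (u * t) d)) ⟩
    + q * (u * t) + + d * v * t        ≡⟨ factor (+ q) u (+ d) v t ⟩
    (+ q * u + + d * v) * t            ≡⟨ cong (_* t) bézout ⟩
    1ℤ * t                             ≡⟨ ℤP.*-identityˡ t ⟩
    t                                  ∎
    where
    open ≡-Reasoning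
    regroup : ∀ Q R k D v t → Q * R + D * (v * t + k * Q) ≡ Q * (R + k * D) + D * v * t
    regroup = solve-∀
    factor : ∀ Q u D v t → Q * (u * t) + D * v * t ≡ (Q * u + D * v) * t
    factor = solve-∀

  d*y≡t-q*r : + d * y ≡ t - + q * + r
  d*y≡t-q*r = trans (isolate (+ q * + r) (+ d * y)) (cong (_- + q * + r) solves)
    where
    isolate : ∀ A B → B ≡ A + B - A
    isolate = solve-∀

  d*∣y∣≤d*K : d ℕ.* ∣ y ∣ ≤ℕ d ℕ.* K
  d*∣y∣≤d*K = begin
    d ℕ.* ∣ y ∣                ≡⟨ sym (ℤP.abs-* (+ d) y) ⟩
    ∣ + d * y ∣                ≡⟨ cong ∣_∣ d*y≡t-q*r ⟩
    ∣ t - + q * + r ∣          ≤⟨ ℤP.∣i-j∣≤∣i∣+∣j∣ t (+ q * + r) ⟩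
    ∣ t ∣ ℕ.+ ∣ + q * + r ∣    ≡⟨ cong (∣ t ∣ ℕ.+_) (ℤP.abs-* (+ q) (+ r)) ⟩
    ∣ t ∣ ℕ.+ q ℕ.* r          ≤⟨ ℕP.+-mono-≤ t≤K (ℕP.*-monoˡ-≤ r q≤K) ⟩
    K ℕ.+ K ℕ.* r              ≡⟨ cong (K ℕ.+_) (ℕP.*-comm K r) ⟩
    suc r ℕ.* K                ≤⟨ ℕP.*-monoˡ-≤ K r<d ⟩
    d ℕ.* K                    ∎
    where open ℕP.≤-Reasoning

  y≤K : ∣ y ∣ ≤ℕ K
  y≤K = ℕP.*-cancelˡ-≤ d d*∣y∣≤d*K

scale-combination : ∀ g q d x y → + (g ℕ.* q) * x + + (g ℕ.* d) * y ≡ + g * (+ q * x + + d * y)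
scale-combination g q d x y =
  trans (cong₂ (λ a b → a * x + b * y) (ℤP.pos-* g q) (ℤP.pos-* g d)) (distribute (+ g) (+ q) (+ d) x y)
  where
  distribute : ∀ G Q D x y → G * Q * x + G * D * y ≡ G * (Q * x + D * y)
  distribute = solve-∀

∷-bounded : ∀ {m K x} {c : Fin m → ℤ} → ∣ x ∣ ≤ℕ K → (∀ i → ∣ c i ∣ ≤ℕ K) → ∀ i → ∣ (x ∷ c) i ∣ ≤ℕ K
∷-bounded x≤K c≤K zero    = x≤K
∷-bounded x≤K c≤K (suc i) = c≤K i

spans-∷-factored : ∀ {m} (bs : Fin (suc m) → ℤ) {g q d h K} .{{_ : NonZero d}} →
  g ℕ.* q ≡ ∣ head bs ∣ → g ℕ.* d ≡ h → Coprime q d → q ≤ℕ K → d ≤ℕ K →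
  Spans (tail bs) h K → Spans bs g K
spans-∷-factored bs {g} {q} {d} {h} {K} g*q≡p g*d≡h cop q≤K d≤K spans-tail t t≤K =
  let (x , y , x≤K , y≤K , qx+dy≡t) = two-term cop q≤K d≤K t t≤K
      (x′ , b₀x′≡px , ∣x′∣≡∣x∣) = absorb-sign (head bs) x
      (c′ , c′≤K , dot≡hy) = spans-tail y y≤K
  in x′ ∷ c′ , ∷-bounded (subst (_≤ℕ K) (sym ∣x′∣≡∣x∣) x≤K) c′≤K , assemble b₀x′≡px dot≡hy qx+dy≡t
  where
  assemble : ∀ {x y x′ s} → head bs * x′ ≡ + ∣ head bs ∣ * x → s ≡ + h * y →
    + q * x + + d * y ≡ t → head bs * x′ + s ≡ + g * t
  assemble {x} {y} {x′} {s} b₀x′≡px s≡hy qx+dy≡t = begin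
    head bs * x′ + s                      ≡⟨ cong₂ _+_ b₀x′≡px s≡hy ⟩
    + ∣ head bs ∣ * x + + h * y           ≡⟨ cong₂ (λ a b → + a * x + + b * y) (sym g*q≡p) (sym g*d≡h) ⟩
    + (g ℕ.* q) * x + + (g ℕ.* d) * y     ≡⟨ scale-combination g q d x y ⟩
    + g * (+ q * x + + d * y)             ≡⟨ cong (+ g *_) qx+dy≡t ⟩
    + g * t                               ∎
    where open ≡-Reasoning

spans-∷ : ∀ {m} (bs : Fin (suc m) → ℤ) h K →
  ∣ head bs ∣ ≤ℕ gcd ∣ head bs ∣ h ℕ.* K → h ≤ℕ gcd ∣ head bs ∣ h ℕ.* K →
  Spans (tail bs) h K → Spans bs (gcd ∣ head bs ∣ h) K
-- h = 0: the tail contributes nothing and b₀·(±t) = |b₀|·t = gcd(|b₀|, 0)·t.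
spans-∷ bs zero K _ _ spans-tail t t≤K =
  let (x , b₀x≡pt , ∣x∣≡∣t∣) = absorb-sign (head bs) t
      (c′ , c′≤K , dot≡0) = spans-tail 0ℤ ℕ.z≤n
  in x ∷ c′ , ∷-bounded (subst (_≤ℕ K) (sym ∣x∣≡∣t∣) t≤K) c′≤K , assemble b₀x≡pt dot≡0
  where
  p = ∣ head bs ∣
  assemble : ∀ {x s} → head bs * x ≡ + p * t → s ≡ 0ℤ → head bs * x + s ≡ + gcd p 0 * t
  assemble {x} {s} b₀x≡pt s≡0 = begin
    head bs * x + s    ≡⟨ cong (λ z → head bs * x + z) s≡0 ⟩
    head bs * x + 0ℤ   ≡⟨ ℤP.+-identityʳ (head bs * x) ⟩
    head bs * x        ≡⟨ b₀x≡pt ⟩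
    + p * t            ≡⟨ cong (λ z → + z * t) (sym (gcd-identityʳ p)) ⟩
    + gcd p 0 * t      ∎
    where open ≡-Reasoning
-- h ≠ 0: divide |b₀| and h by their gcd g, which leaves coprime quotients.
spans-∷ bs h@(suc _) K p≤gK h≤gK spans-tail =
  spans-∷-factored bs {g} {p / g} {h / g} {h} {K} {{d≢0}}
    (m*[n/m]≡n g∣p) (m*[n/m]≡n g∣h) (coprime-/gcd p h)
    (quotient-≤ K g∣p p≤gK) (quotient-≤ K g∣h h≤gK) spans-tail
  where
  p = ∣ head bs ∣
  g = gcd p h
  instance
    g≢0 : NonZero g
    g≢0 = ℕ.≢-nonZero (gcd[m,n]≢0 p h (inj₂ λ ()))
  g∣p : g ∣ p
  g∣p = gcd[m,n]∣m p h
  g∣h : g ∣ h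
  g∣h = gcd[m,n]∣n p h
  d≢0 : NonZero (h / g)
  d≢0 = ℕ.>-nonZero (m≥n⇒m/n>0 (gcd[m,n]≤n p h))

spans-gcdᶠ : ∀ {m} (bs : Fin m → ℤ) K → (∀ i → ∣ bs i ∣ ≤ℕ gcdᶠ bs ℕ.* K) → Spans bs (gcdᶠ bs) K
spans-gcdᶠ {zero}  bs K _ t _ = (λ ()) , (λ ()) , refl
spans-gcdᶠ {suc m} bs K bounded =
  spans-∷ bs h K (bounded zero) (gcdᶠ-≤ (tail bs) (λ i → bounded (suc i)))
    (spans-gcdᶠ (tail bs) K tail-bounded)
  where
  h = gcdᶠ (tail bs)
  tail-bounded : ∀ i → ∣ tail bs i ∣ ≤ℕ h ℕ.* K
  tail-bounded i = ≤-*-divisor K (gcd[m,n]∣n ∣ head bs ∣ h) (gcdᶠ-∣ (tail bs) i) (bounded (suc i))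

lemmaA7 : (m K : ℕ) → .{{_ : NonZero m}} → .{{_ : NonZero K}} →
    (bs : Fin m → ℤ) → gcdᶠ bs ≡ 1 → (∀ i → ∣ bs i ∣ ≤ℕ K) →
    (b : ℤ) → ∣ b ∣ ≤ℕ K →
    Σ (Fin m → ℤ) (λ c → (∀ i → ∣ c i ∣ ≤ℕ K) × dotᶠ bs c ≡ b)
lemmaA7 m K bs gcd≡1 bounded b b≤K =
  let (c , c≤K , dot≡gb) = spans-gcdᶠ bs K scaled-bounds b b≤K
  in c , c≤K , trans dot≡gb (trans (cong (λ g → + g * b) gcd≡1) (ℤP.*-identityˡ b))
  where
  scaled-bounds : ∀ i → ∣ bs i ∣ ≤ℕ gcdᶠ bs ℕ.* K
  scaled-bounds i = subst (λ g → ∣ bs i ∣ ≤ℕ g ℕ.* K) (sym gcd≡1)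
                      (subst (∣ bs i ∣ ≤ℕ_) (sym (ℕP.*-identityˡ K)) (bounded i))
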